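{- Let ${\bf n}=n_0n_1n_2\cdots$ be the fixed point starting with $0$ of the morphism $0\mapsto01$, $1\mapsto2$, $2\mapsto0$. For $m\ge1$ let $A_m$ be the least integer $x$ such that every length-$m$ factor of ${\bf n}$ occurs in ${\bf n}$ at some starting position $j\le x$ (positions indexed from $0$). For $i\ge0$ let $D_i=\lfloor (N_i-N_{i+1}+2N_{i+2})/3\rfloor$. Then for every $m\ge2$ and every $i\ge0$ with $D_i<m\le D_{i+1}$, we have $A_m=N_{i+4}-1$.
   Context: The Narayana numbers are defined by $N_0=1$, $N_1=2$, $N_2=3$ and $N_i=N_{i-1}+N_{i-3}$ for $i\ge3$. -}

module Defs where

open import Data.Nat using (ℕ; zero; suc; _+_; _*_; _∸_; _≤_; _<_)
open import Data.Nat.DivMod using (_/_)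
open import Data.Fin using (Fin; zero; suc)
open import Data.List using (List; []; _∷_; concatMap)
open import Data.Product using (∃; _×_)
open import Relation.Binary.PropositionalEquality using (_≡_)

N : ℕ → ℕ
N zero = 1
N (suc zero) = 2
N (suc (suc zero)) = 3
N (suc (suc (suc i))) = N (suc (suc i)) + N i

φ₁ : Fin 3 → List (Fin 3)
φ₁ zero = zero ∷ suc zero ∷ []
φ₁ (suc zero) = suc (suc zero) ∷ []
φ₁ (suc (suc zero)) = zero ∷ []

φ : List (Fin 3) → List (Fin 3)
φ = concatMap φ₁

φ^ : ℕ → List (Fin 3)
φ^ zero = zero ∷ []
φ^ (suc k) = φ (φ^ k)

-- total list indexing with a default value (only used in range)
at : List (Fin 3) → ℕ → Fin 3
at [] _ = zero
at (x ∷ xs) zero = x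
at (x ∷ xs) (suc i) = at xs i

-- The fixed point n = n₀ n₁ n₂ ⋯ of φ starting with 0:
-- n_i is the i-th letter of the prefix φ^(i+1)(0), which has length ≥ i+2.
word : ℕ → Fin 3
word i = at (φ^ (suc i)) i

OccursAt : ℕ → ℕ → ℕ → Set
OccursAt m k j = ∀ t → t < m → word (j + t) ≡ word (k + t)

AllFactorsBy : ℕ → ℕ → Set
AllFactorsBy m x = ∀ k → ∃ λ j → j ≤ x × OccursAt m k j

IsA : ℕ → ℕ → Set
IsA m x = AllFactorsBy m x × (∀ y → AllFactorsBy m y → x ≤ y)

-- D_i = ⌊(N_i - N_{i+1} + 2 N_{i+2}) / 3⌋  (numerator is nonnegative)
D : ℕ → ℕ
D i = (N i + 2 * N (suc (suc i)) ∸ N (suc i)) / 3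

module Submission where

-- Since n = φ(n), the letter n_p is replaced by the block φ(n_p), which starts at position
-- start p = |φ(n₀ ⋯ n_{p-1})|; iterating, the cuts start^(i+2) q split n into the blocks
-- φ^(i+2)(n_q).  Two recognizability facts drive the proof, where β i + 1 = D i: every cut
-- is followed by the prefix of n of length β (i + 1), and the prefix of length β i + 1
-- occurs only at cuts.  Upper bound: a factor of length m ≤ D (i + 1) starting in block q
-- also starts, at the same offset, in the block of the first occurrence q₀ ≤ 2 of the letter
-- n_q, since both blocks are followed by the same prefix; that block ends before
-- |φ^(i+2)(012)| = |φ^(i+4)(0)| = N (i + 4), as φ^(k+3)(0) = φ^(k+2)(0) φ^k(0).  Lower
-- bound: the factor at N (i + 4) − 1 is the last letter of φ^(i+4)(0) followed by that
-- prefix, so an earlier occurrence at j makes j + 1 the first or second cut, i.e.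
-- j = N (i + 2) − 1 or N (i + 3) − 1; but the last letters of φ^k(0) cycle through 0, 1, 2.
-- Finally D i = β i + 1 follows from counting letters: start x = x + #{p < x | n_p = 0}.

open import Defs
open import Data.Nat using (ℕ; zero; suc; _+_; _*_; _∸_; _≤_; _<_; s≤s; z≤n; _<?_; _≤?_)
open import Data.Nat.Properties hiding (_≟_)
open import Data.Nat.DivMod using (_/_; +-distrib-/-∣ʳ; m<n⇒m/n≡0; m*n/n≡m)
open import Data.Nat.Divisibility using (divides-refl)
open import Data.Nat.ListAction using (sum)
open import Data.Nat.Tactic.RingSolver using (solve-∀)
open import Algebra.Properties.CommutativeSemigroup +-commutativeSemigroup using (interchange)
open import Data.Bool using (if_then_else_)
open import Data.Fin using (Fin; zero; suc; toℕ)
open import Data.Fin.Properties using (_≟_; toℕ<n)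
open import Data.List using (List; []; _∷_; _++_; length; take; map)
open import Data.List.Properties using (concatMap-++; length-++; ++-identityʳ; ++-assoc; take-all)
open import Data.Product using (∃; ∃₂; _×_; _,_; proj₁; proj₂)
open import Data.Sum using (_⊎_; inj₁; inj₂)
open import Data.Empty using (⊥; ⊥-elim)
open import Function using (_∘_; case_of_)
open import Relation.Nullary using (does; yes; no)
open import Relation.Binary.PropositionalEquality

pattern 𝟎 = zero
pattern 𝟏 = suc zero
pattern 𝟐 = suc (suc zero)

φ-++ : ∀ xs ys → φ (xs ++ ys) ≡ φ xs ++ φ ys
φ-++ = concatMap-++ φ₁

at-++ˡ : ∀ xs ys {i} → i < length xs → at (xs ++ ys) i ≡ at xs i
at-++ˡ (x ∷ xs) ys {zero}  _         = refl
at-++ˡ (x ∷ xs) ys {suc i} (s≤s i<) = at-++ˡ xs ys i<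

at-++ʳ : ∀ xs ys i → at (xs ++ ys) (length xs + i) ≡ at ys i
at-++ʳ []       ys i = refl
at-++ʳ (x ∷ xs) ys i = at-++ʳ xs ys i

bracket : ∀ (f : ℕ → ℕ) → f 0 ≡ 0 → (∀ p → f p < f (suc p)) →
          ∀ x → ∃₂ λ p d → x ≡ f p + d × x < f (suc p)
bracket f f0≡0 f-< zero = 0 , 0 , sym (trans (+-identityʳ (f 0)) f0≡0) , subst (_< f 1) f0≡0 (f-< 0)
bracket f f0≡0 f-< (suc x) with bracket f f0≡0 f-< x
... | p , d , x≡ , x< with suc x <? f (suc p)
...   | yes sx< = p , suc d , trans (cong suc x≡) (sym (+-suc (f p) d)) , sx<
...   | no  sx≮ = suc p , 0 , trans sx≡ (sym (+-identityʳ _)) , subst (_< f (2 + p)) (sym sx≡) (f-< (suc p))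
  where sx≡ = ≤-antisym x< (≮⇒≥ sx≮)

step-<⇒mono-< : ∀ (f : ℕ → ℕ) → (∀ p → f p < f (suc p)) → ∀ {a b} → a < b → f a < f b
step-<⇒mono-< f f-< {a} {suc b} (s≤s a≤b) with m≤n⇒m<n∨m≡n a≤b
... | inj₁ a<b  = <-trans (step-<⇒mono-< f f-< a<b) (f-< b)
... | inj₂ refl = f-< b

step-<⇒mono-≤ : ∀ (f : ℕ → ℕ) → (∀ p → f p < f (suc p)) → ∀ {a b} → a ≤ b → f a ≤ f b
step-<⇒mono-≤ f f-< a≤b with m≤n⇒m<n∨m≡n a≤b
... | inj₁ a<b  = <⇒≤ (step-<⇒mono-< f f-< a<b)
... | inj₂ refl = ≤-refl

<⇒≤∸1 : ∀ {m n} → m < n → m ≤ n ∸ 1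
<⇒≤∸1 (s≤s m≤n) = m≤n

-- Prefixes φ^k(0) of n

φ^-suc-extends : ∀ k → ∃ λ t → φ^ (suc k) ≡ φ^ k ++ t
φ^-suc-extends zero = 𝟏 ∷ [] , refl
φ^-suc-extends (suc k) with t , eq ← φ^-suc-extends k = φ t , trans (cong φ eq) (φ-++ (φ^ k) t)

φ^-extends : ∀ {k K} → k ≤ K → ∃ λ t → φ^ K ≡ φ^ k ++ t
φ^-extends {k} {K} k≤K with m≤n⇒m<n∨m≡n k≤K
... | inj₂ refl = [] , sym (++-identityʳ (φ^ k))
φ^-extends {k} {suc K} _ | inj₁ (s≤s k≤K)
  with t , eq ← φ^-extends k≤K | u , eq′ ← φ^-suc-extends K
  = t ++ u , trans eq′ (trans (cong (_++ u) eq) (++-assoc (φ^ k) t u))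

φ^-+3 : ∀ k → φ^ (3 + k) ≡ φ^ (2 + k) ++ φ^ k
φ^-+3 zero    = refl
φ^-+3 (suc k) = trans (cong φ (φ^-+3 k)) (φ-++ (φ^ (2 + k)) (φ^ k))

length-φ^ : ∀ k → length (φ^ k) ≡ N k
length-φ^ zero                = refl
length-φ^ (suc zero)          = refl
length-φ^ (suc (suc zero))    = refl
length-φ^ (suc (suc (suc k))) = begin
  length (φ^ (3 + k))                 ≡⟨ cong length (φ^-+3 k) ⟩
  length (φ^ (2 + k) ++ φ^ k)         ≡⟨ length-++ (φ^ (2 + k)) ⟩
  length (φ^ (2 + k)) + length (φ^ k) ≡⟨ cong₂ _+_ (length-φ^ (suc (suc k))) (length-φ^ k) ⟩
  N (2 + k) + N k                     ∎
  where open ≡-Reasoning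

N-positive : ∀ k → 1 ≤ N k
N-positive zero                = s≤s z≤n
N-positive (suc zero)          = s≤s z≤n
N-positive (suc (suc zero))    = s≤s z≤n
N-positive (suc (suc (suc k))) = ≤-trans (N-positive (suc (suc k))) (m≤m+n _ _)

n<N : ∀ k → k < N k
n<N zero                = s≤s z≤n
n<N (suc zero)          = s≤s (s≤s z≤n)
n<N (suc (suc zero))    = s≤s (s≤s (s≤s z≤n))
n<N (suc (suc (suc k))) =
  subst (_≤ N (3 + k)) (+-comm (3 + k) 1) (+-mono-≤ (n<N (suc (suc k))) (N-positive k))

lastLetter : ℕ → Fin 3
lastLetter k = at (φ^ k) (N k ∸ 1)

lastLetter-+3 : ∀ k → lastLetter (3 + k) ≡ lastLetter k
lastLetter-+3 k = begin
  at (φ^ (3 + k)) (N (3 + k) ∸ 1)                        ≡⟨ cong₂ at (φ^-+3 k) index≡ ⟩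
  at (φ^ (2 + k) ++ φ^ k) (length (φ^ (2 + k)) + (N k ∸ 1)) ≡⟨ at-++ʳ (φ^ (2 + k)) (φ^ k) (N k ∸ 1) ⟩
  at (φ^ k) (N k ∸ 1)                                    ∎
  where
  open ≡-Reasoning
  index≡ : N (3 + k) ∸ 1 ≡ length (φ^ (2 + k)) + (N k ∸ 1)
  index≡ = trans (+-∸-assoc (N (2 + k)) (N-positive k)) (cong (_+ (N k ∸ 1)) (sym (length-φ^ (2 + k))))

lastLetter-suc-≢ : ∀ k → lastLetter k ≢ lastLetter (suc k)
lastLetter-suc-≢ zero             ()
lastLetter-suc-≢ (suc zero)       ()
lastLetter-suc-≢ (suc (suc zero)) ()
lastLetter-suc-≢ (suc (suc (suc k))) eq =
  lastLetter-suc-≢ k (trans (sym (lastLetter-+3 k)) (trans eq (lastLetter-+3 (suc k))))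

at-φ^-stable : ∀ {k K i} → k ≤ K → i < N k → at (φ^ K) i ≡ at (φ^ k) i
at-φ^-stable {k} k≤K i< with t , eq ← φ^-extends k≤K =
  trans (cong (λ xs → at xs _) eq) (at-++ˡ (φ^ k) t (subst (_ <_) (sym (length-φ^ k)) i<))

word-φ^ : ∀ K {i} → i < N K → word i ≡ at (φ^ K) i
word-φ^ K {i} i< with ≤-total K (suc i)
... | inj₁ K≤ = at-φ^-stable K≤ i<
... | inj₂ ≤K = sym (at-φ^-stable ≤K (≤-trans (n≤1+n _) (n<N (suc i))))

-- Images of letters in n = φ(n)

-- Opaque, so that unification never unfolds the fixed point.
opaque
  w : ℕ → Fin 3
  w = word

  w≡word : ∀ i → w i ≡ word i
  w≡word i = refl

w-toℕ : ∀ a → w (toℕ a) ≡ a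
w-toℕ 𝟎 = w≡word 0
w-toℕ 𝟏 = w≡word 1
w-toℕ 𝟐 = w≡word 2

len : Fin 3 → ℕ
len a = length (φ₁ a)

len-positive : ∀ a → 1 ≤ len a
len-positive 𝟎 = s≤s z≤n
len-positive 𝟏 = s≤s z≤n
len-positive 𝟐 = s≤s z≤n

-- imageLength a ℓ = |φ(n_a ⋯ n_{a+ℓ-1})|, so φ(n_p) occupies the positions from start p
-- to start (suc p) − 1 of n.
imageLength : ℕ → ℕ → ℕ
imageLength a zero    = 0
imageLength a (suc ℓ) = imageLength a ℓ + len (w (a + ℓ))

start : ℕ → ℕ
start = imageLength 0

start-< : ∀ p → start p < start (suc p)
start-< p = subst (_≤ start (suc p)) (+-comm (start p) 1) (+-monoʳ-≤ (start p) (len-positive (w p)))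

n≤start : ∀ p → p ≤ start p
n≤start zero    = z≤n
n≤start (suc p) = ≤-trans (s≤s (n≤start p)) (start-< p)

length-φ-take-suc : ∀ xs {p} → p < length xs →
                    length (φ (take (suc p) xs)) ≡ length (φ (take p xs)) + len (at xs p)
length-φ-take-suc (x ∷ xs) {zero} _ = trans (cong length (++-identityʳ (φ₁ x))) (sym (+-identityˡ _))
length-φ-take-suc (x ∷ xs) {suc p} (s≤s p<) = begin
  length (φ₁ x ++ φ (take (suc p) xs))           ≡⟨ length-++ (φ₁ x) ⟩
  len x + length (φ (take (suc p) xs))           ≡⟨ cong (len x +_) (length-φ-take-suc xs p<) ⟩
  len x + (length (φ (take p xs)) + len (at xs p)) ≡⟨ +-assoc (len x) _ _ ⟨
  len x + length (φ (take p xs)) + len (at xs p) ≡⟨ cong (_+ len (at xs p)) (length-++ (φ₁ x)) ⟨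
  length (φ₁ x ++ φ (take p xs)) + len (at xs p) ∎
  where open ≡-Reasoning

at-φ : ∀ xs {p r} → p < length xs → r < len (at xs p) →
       at (φ xs) (length (φ (take p xs)) + r) ≡ at (φ₁ (at xs p)) r
at-φ (x ∷ xs) {zero}  _        r< = at-++ˡ (φ₁ x) (φ xs) r<
at-φ (x ∷ xs) {suc p} {r} (s≤s p<) r< = begin
  at (φ₁ x ++ φ xs) (length (φ₁ x ++ φ (take p xs)) + r)
    ≡⟨ cong (λ i → at (φ₁ x ++ φ xs) (i + r)) (length-++ (φ₁ x)) ⟩
  at (φ₁ x ++ φ xs) (len x + length (φ (take p xs)) + r)
    ≡⟨ cong (at (φ₁ x ++ φ xs)) (+-assoc (len x) _ r) ⟩
  at (φ₁ x ++ φ xs) (len x + (length (φ (take p xs)) + r))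
    ≡⟨ at-++ʳ (φ₁ x) (φ xs) _ ⟩
  at (φ xs) (length (φ (take p xs)) + r)
    ≡⟨ at-φ xs p< r< ⟩
  at (φ₁ (at xs p)) r ∎
  where open ≡-Reasoning

w-φ^ : ∀ K {i} → i < N K → w i ≡ at (φ^ K) i
w-φ^ K i< = trans (w≡word _) (word-φ^ K i<)

w-N∸1 : ∀ k → w (N k ∸ 1) ≡ lastLetter k
w-N∸1 k = w-φ^ k (∸-monoʳ-< {o = 0} (s≤s z≤n) (N-positive k))

length-φ-take-φ^ : ∀ K {p} → p ≤ N K → length (φ (take p (φ^ K))) ≡ start p
length-φ-take-φ^ K {zero}  _  = refl
length-φ-take-φ^ K {suc p} p< = begin
  length (φ (take (suc p) (φ^ K)))
    ≡⟨ length-φ-take-suc (φ^ K) (subst (p <_) (sym (length-φ^ K)) p<) ⟩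
  length (φ (take p (φ^ K))) + len (at (φ^ K) p)
    ≡⟨ cong₂ _+_ (length-φ-take-φ^ K (<⇒≤ p<)) (cong len (sym (w-φ^ K p<))) ⟩
  start p + len (w p) ∎
  where open ≡-Reasoning

start-N : ∀ k → start (N k) ≡ N (suc k)
start-N k = begin
  start (N k)                           ≡⟨ length-φ-take-φ^ k ≤-refl ⟨
  length (φ (take (N k) (φ^ k)))        ≡⟨ cong (length ∘ φ) (take-all (N k) (φ^ k) (≤-reflexive (length-φ^ k))) ⟩
  length (φ^ (suc k))                   ≡⟨ length-φ^ (suc k) ⟩
  N (suc k)                             ∎
  where open ≡-Reasoning

w-image : ∀ p {r} → r < len (w p) → w (start p + r) ≡ at (φ₁ (w p)) r
w-image p {r} r< = begin
  w (start p + r)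
    ≡⟨ w-φ^ (suc K) (<-trans (n<1+n K) (n<N (suc K))) ⟩
  at (φ (φ^ K)) (start p + r)
    ≡⟨ cong (λ i → at (φ (φ^ K)) (i + r)) (length-φ-take-φ^ K (<⇒≤ p<N)) ⟨
  at (φ (φ^ K)) (length (φ (take p (φ^ K))) + r)
    ≡⟨ at-φ (φ^ K) (subst (p <_) (sym (length-φ^ K)) p<N) (subst (λ a → r < len a) w≡at r<) ⟩
  at (φ₁ (at (φ^ K) p)) r
    ≡⟨ cong (λ a → at (φ₁ a) r) w≡at ⟨
  at (φ₁ (w p)) r ∎
  where
  open ≡-Reasoning
  K = start p + r
  p<N : p < N K
  p<N = ≤-<-trans (≤-trans (n≤start p) (m≤m+n (start p) r)) (n<N K)
  w≡at : w p ≡ at (φ^ K) p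
  w≡at = w-φ^ K p<N

-- Local structure of n

initial : Fin 3 → Fin 3
initial a = at (φ₁ a) 0

initial≢𝟏 : ∀ a → initial a ≢ 𝟏
initial≢𝟏 𝟎 ()
initial≢𝟏 𝟏 ()
initial≢𝟏 𝟐 ()

initial≡𝟎 : ∀ {a} → a ≢ 𝟏 → initial a ≡ 𝟎
initial≡𝟎 {𝟎} _   = refl
initial≡𝟎 {𝟏} a≢𝟏 = ⊥-elim (a≢𝟏 refl)
initial≡𝟎 {𝟐} _   = refl

initial≡𝟐 : ∀ {a} → initial a ≡ 𝟐 → a ≡ 𝟏
initial≡𝟐 {𝟎} ()
initial≡𝟐 {𝟏} _ = refl
initial≡𝟐 {𝟐} ()

w-start : ∀ p → w (start p) ≡ initial (w p)
w-start p = trans (cong w (sym (+-identityʳ (start p)))) (w-image p (len-positive (w p)))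

w-start-of : ∀ {p a} → w p ≡ a → w (start p) ≡ initial a
w-start-of {p} wp≡a = trans (w-start p) (cong initial wp≡a)

start-suc-of : ∀ {p a} → w p ≡ a → start (suc p) ≡ start p + len a
start-suc-of {p} wp≡a = cong (λ b → start p + len b) wp≡a

w-start+1 : ∀ {p} → w p ≡ 𝟎 → w (start p + 1) ≡ 𝟏
w-start+1 {p} wp≡𝟎 = trans (w-image p (subst (λ a → 1 < len a) (sym wp≡𝟎) (s≤s (s≤s z≤n))))
                           (cong (λ a → at (φ₁ a) 1) wp≡𝟎)

w-start≢𝟏 : ∀ p → w (start p) ≢ 𝟏
w-start≢𝟏 p = subst (_≢ 𝟏) (sym (w-start p)) (initial≢𝟏 (w p))

start-or-start+1 : ∀ x → (∃ λ p → x ≡ start p) ⊎ (∃ λ p → w p ≡ 𝟎 × x ≡ start p + 1)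
start-or-start+1 x with p , d , refl , x< ← bracket start refl start-< x =
  within-image p d (+-cancelˡ-< (start p) d (len (w p)) x<)
  where
  within-image : ∀ p d → d < len (w p) →
                 (∃ λ q → start p + d ≡ start q) ⊎ (∃ λ q → w q ≡ 𝟎 × start p + d ≡ start q + 1)
  within-image p zero    _  = inj₁ (p , +-identityʳ (start p))
  within-image p (suc d) d< with w p in wp | d<
  ... | 𝟎 | s≤s (s≤s z≤n) = inj₂ (p , wp , refl)
  ... | 𝟏 | s≤s ()
  ... | 𝟐 | s≤s ()

w≢𝟏⇒start : ∀ {x} → w x ≢ 𝟏 → ∃ λ p → x ≡ start p
w≢𝟏⇒start {x} wx≢𝟏 with start-or-start+1 x
... | inj₁ x≡start           = x≡start
... | inj₂ (p , wp≡𝟎 , refl) = ⊥-elim (wx≢𝟏 (w-start+1 wp≡𝟎))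

𝟏-preceded-by-𝟎 : ∀ {x} → w (suc x) ≡ 𝟏 → w x ≡ 𝟎
𝟏-preceded-by-𝟎 {x} wsx≡𝟏 with start-or-start+1 (suc x)
... | inj₁ (p , sx≡)          = ⊥-elim (w-start≢𝟏 p (subst (λ y → w y ≡ 𝟏) sx≡ wsx≡𝟏))
... | inj₂ (p , wp≡𝟎 , sx≡) = trans (cong w (suc-injective (trans sx≡ (+-comm (start p) 1)))) (w-start-of wp≡𝟎)

𝟏𝟏-free : ∀ {x} → w x ≡ 𝟏 → w (suc x) ≢ 𝟏
𝟏𝟏-free wx≡𝟏 wsx≡𝟏 with () ← trans (sym wx≡𝟏) (𝟏-preceded-by-𝟎 wsx≡𝟏)

𝟐-preceded-by-𝟏 : ∀ {x} → w (suc x) ≡ 𝟐 → w x ≡ 𝟏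
𝟐-preceded-by-𝟏 {x} wsx≡𝟐
  with w≢𝟏⇒start {suc x} (λ wsx≡𝟏 → case trans (sym wsx≡𝟐) wsx≡𝟏 of λ ())
... | suc p , sx≡ = trans (cong w x≡) (w-start+1 wp≡𝟎)
  where
  wsp≡𝟏 : w (suc p) ≡ 𝟏
  wsp≡𝟏 = initial≡𝟐 (trans (sym (w-start (suc p))) (trans (cong w (sym sx≡)) wsx≡𝟐))
  wp≡𝟎 : w p ≡ 𝟎
  wp≡𝟎 = 𝟏-preceded-by-𝟎 wsp≡𝟏
  x≡ : x ≡ start p + 1
  x≡ = suc-injective (trans sx≡ (trans (start-suc-of wp≡𝟎) (+-suc (start p) 1)))

w-start-after-𝟏 : ∀ {x} → w x ≡ 𝟏 → w (start (suc x)) ≡ 𝟎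
w-start-after-𝟏 {x} wx≡𝟏 = trans (w-start (suc x)) (initial≡𝟎 (𝟏𝟏-free wx≡𝟏))

decode-image : ∀ {p q} → w (start p) ≡ w (start q) → w (start p + 1) ≡ w (start q + 1) →
               w p ≡ w q
decode-image {p} {q} e₀ e₁ with w p in wp | w q in wq
... | 𝟎 | 𝟎 = refl
... | 𝟏 | 𝟏 = refl
... | 𝟐 | 𝟐 = refl
... | 𝟎 | 𝟐 = ⊥-elim (w-start≢𝟏 (suc q) (trans (cong w (start-suc-of wq)) (trans (sym e₁) (w-start+1 wp))))
... | 𝟐 | 𝟎 = ⊥-elim (w-start≢𝟏 (suc p) (trans (cong w (start-suc-of wp)) (trans e₁ (w-start+1 wq))))
... | 𝟎 | 𝟏 with () ← trans (sym (w-start-of wp)) (trans e₀ (w-start-of wq))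
... | 𝟏 | 𝟎 with () ← trans (sym (w-start-of wp)) (trans e₀ (w-start-of wq))
... | 𝟏 | 𝟐 with () ← trans (sym (w-start-of wp)) (trans e₀ (w-start-of wq))
... | 𝟐 | 𝟏 with () ← trans (sym (w-start-of wp)) (trans e₀ (w-start-of wq))

w-start≡𝟎⇒≢𝟏 : ∀ {p} → w (start p) ≡ 𝟎 → w p ≢ 𝟏
w-start≡𝟎⇒≢𝟏 {p} e wp≡𝟏 with () ← trans (sym e) (w-start-of wp≡𝟏)

decode-image-after-𝟎 : ∀ {x y} → w x ≡ 𝟎 → w y ≡ 𝟎 →
                       w (start (suc x)) ≡ w (start (suc y)) → w (suc x) ≡ w (suc y)
decode-image-after-𝟎 {x} {y} wx wy e with w (suc x) in wsx | w (suc y) in wsy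
... | 𝟎 | 𝟎 = refl
... | 𝟏 | 𝟏 = refl
... | 𝟎 | 𝟏 with () ← trans (sym (w-start-of wsx)) (trans e (w-start-of wsy))
... | 𝟏 | 𝟎 with () ← trans (sym (w-start-of wsx)) (trans e (w-start-of wsy))
... | 𝟐 | _ with () ← trans (sym wx) (𝟐-preceded-by-𝟏 wsx)
... | _ | 𝟐 with () ← trans (sym wy) (𝟐-preceded-by-𝟏 wsy)

w≡𝟎⇒start : ∀ {x} → w x ≡ 𝟎 → ∃ λ p → x ≡ start p
w≡𝟎⇒start wx≡𝟎 = w≢𝟏⇒start (λ wx≡𝟏 → case trans (sym wx≡𝟎) wx≡𝟏 of λ ())

w≡𝟎⇒start² : ∀ {x} → w x ≡ 𝟎 → ∃ λ q → x ≡ start (start q)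
w≡𝟎⇒start² wx≡𝟎
  with a , refl ← w≡𝟎⇒start wx≡𝟎
  with q , refl ← w≢𝟏⇒start {a} (w-start≡𝟎⇒≢𝟏 wx≡𝟎) = q , refl

Agree : ℕ → ℕ → ℕ → Set
Agree ℓ a b = ∀ t → t < ℓ → w (a + t) ≡ w (b + t)

Agree⇒OccursAt : ∀ {m j k} → Agree m j k → OccursAt m k j
Agree⇒OccursAt agr t t< = trans (sym (w≡word _)) (trans (agr t t<) (w≡word _))

OccursAt⇒Agree : ∀ {m j k} → OccursAt m k j → Agree m j k
OccursAt⇒Agree occ t t< = trans (w≡word _) (trans (occ t t<) (sym (w≡word _)))

Agree-≤ : ∀ {ℓ′ ℓ a b} → ℓ′ ≤ ℓ → Agree ℓ a b → Agree ℓ′ a b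
Agree-≤ ℓ′≤ℓ agr t t< = agr t (≤-trans t< ℓ′≤ℓ)

Agree-sym : ∀ {ℓ a b} → Agree ℓ a b → Agree ℓ b a
Agree-sym agr t t< = sym (agr t t<)

Agree-trans : ∀ {ℓ a b c} → Agree ℓ a b → Agree ℓ b c → Agree ℓ a c
Agree-trans agr agr′ t t< = trans (agr t t<) (agr′ t t<)

Agree-head : ∀ {ℓ a b} → Agree (suc ℓ) a b → w a ≡ w b
Agree-head {a = a} {b} agr = subst₂ (λ x y → w x ≡ w y) (+-identityʳ a) (+-identityʳ b) (agr 0 (s≤s z≤n))

Agree-++ : ∀ {ℓ k a b} → Agree ℓ a b → Agree k (a + ℓ) (b + ℓ) → Agree (ℓ + k) a b
Agree-++ {ℓ} {k} {a} {b} agr agr′ t t< with t <? ℓ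
... | yes t<ℓ = agr t t<ℓ
... | no  t≮ℓ = begin
  w (a + t)            ≡⟨ cong (λ i → w (a + i)) t≡ ⟨
  w (a + (ℓ + u))      ≡⟨ cong w (+-assoc a ℓ u) ⟨
  w (a + ℓ + u)        ≡⟨ agr′ u (+-cancelˡ-< ℓ u k (subst (_< ℓ + k) (sym t≡) t<)) ⟩
  w (b + ℓ + u)        ≡⟨ cong w (+-assoc b ℓ u) ⟩
  w (b + (ℓ + u))      ≡⟨ cong (λ i → w (b + i)) t≡ ⟩
  w (b + t)            ∎
  where
  open ≡-Reasoning
  u = t ∸ ℓ
  t≡ : ℓ + u ≡ t
  t≡ = m+[n∸m]≡n (≮⇒≥ t≮ℓ)

Agree-1 : ∀ {a b} → w a ≡ w b → Agree 1 a b
Agree-1 {a} {b} e zero    _        = subst₂ (λ x y → w x ≡ w y) (sym (+-identityʳ a)) (sym (+-identityʳ b)) e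
Agree-1         e (suc _) (s≤s ())

Agree-snoc : ∀ {ℓ a b} → Agree ℓ a b → w (a + ℓ) ≡ w (b + ℓ) → Agree (suc ℓ) a b
Agree-snoc {ℓ} {a} {b} agr e = subst (λ k → Agree k a b) (+-comm ℓ 1) (Agree-++ agr (Agree-1 e))

Agree-drop : ∀ {n a b} t {m} → t + m ≤ n → Agree n a b → Agree m (a + t) (b + t)
Agree-drop {a = a} {b} t t+m≤n agr s s< =
  trans (cong w (+-assoc a t s))
        (trans (agr (t + s) (≤-trans (+-monoʳ-< t s<) t+m≤n)) (cong w (sym (+-assoc b t s))))

start-+ : ∀ a ℓ → start (a + ℓ) ≡ start a + imageLength a ℓ
start-+ a zero    = trans (cong start (+-identityʳ a)) (sym (+-identityʳ (start a)))
start-+ a (suc ℓ) = begin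
  start (a + suc ℓ)                                ≡⟨ cong start (+-suc a ℓ) ⟩
  start (a + ℓ) + len (w (a + ℓ))                  ≡⟨ cong (_+ len (w (a + ℓ))) (start-+ a ℓ) ⟩
  start a + imageLength a ℓ + len (w (a + ℓ))      ≡⟨ +-assoc (start a) _ _ ⟩
  start a + imageLength a (suc ℓ)                  ∎
  where open ≡-Reasoning

Agree⇒imageLength≡ : ∀ {ℓ a b} → Agree ℓ a b → imageLength a ℓ ≡ imageLength b ℓ
Agree⇒imageLength≡ {zero}  agr = refl
Agree⇒imageLength≡ {suc ℓ} agr =
  cong₂ _+_ (Agree⇒imageLength≡ (Agree-≤ (n≤1+n ℓ) agr)) (cong len (agr ℓ (n<1+n ℓ)))

Agree-image : ∀ {ℓ a b} → Agree ℓ a b → Agree (imageLength a ℓ) (start a) (start b)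
Agree-image {zero}          agr t ()
Agree-image {suc ℓ} {a} {b} agr = Agree-++ (Agree-image agr′) image-of-last
  where
  agr′ = Agree-≤ (n≤1+n ℓ) agr
  wab : w (a + ℓ) ≡ w (b + ℓ)
  wab = agr ℓ (n<1+n ℓ)
  start-b+ℓ≡ : start (b + ℓ) ≡ start b + imageLength a ℓ
  start-b+ℓ≡ = trans (start-+ b ℓ) (cong (start b +_) (sym (Agree⇒imageLength≡ agr′)))
  image-of-last : Agree (len (w (a + ℓ))) (start a + imageLength a ℓ) (start b + imageLength a ℓ)
  image-of-last r r< = begin
      w (start a + imageLength a ℓ + r)   ≡⟨ cong (λ i → w (i + r)) (start-+ a ℓ) ⟨
      w (start (a + ℓ) + r)               ≡⟨ w-image (a + ℓ) r< ⟩
      at (φ₁ (w (a + ℓ))) r               ≡⟨ cong (λ c → at (φ₁ c) r) wab ⟩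
      at (φ₁ (w (b + ℓ))) r               ≡⟨ w-image (b + ℓ) (subst (λ c → r < len c) wab r<) ⟨
      w (start (b + ℓ) + r)               ≡⟨ cong (λ i → w (i + r)) start-b+ℓ≡ ⟩
      w (start b + imageLength a ℓ + r)   ∎
    where open ≡-Reasoning

start-+-prefix : ∀ {a ℓ} → Agree ℓ a 0 → start (a + ℓ) ≡ start a + start ℓ
start-+-prefix {a} {ℓ} agr = trans (start-+ a ℓ) (cong (start a +_) (Agree⇒imageLength≡ agr))

Agree-start-prefix : ∀ {ℓ a} → Agree ℓ a 0 → Agree (start ℓ) (start a) 0
Agree-start-prefix {ℓ} {a} agr = subst (λ k → Agree k (start a) 0) (Agree⇒imageLength≡ agr) (Agree-image agr)

Agree-preimage-prefix : ∀ {ℓ a} → Agree (start ℓ + 1) (start a) 0 → Agree ℓ a 0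
Agree-preimage-prefix {zero}      agr t ()
Agree-preimage-prefix {suc ℓ} {a} agr = Agree-snoc agr′ (decode-image e₀ e₁)
  where
  agr′ : Agree ℓ a 0
  agr′ = Agree-preimage-prefix (Agree-≤ (+-monoˡ-≤ 1 (<⇒≤ (start-< ℓ))) agr)
  sa≡ : start (a + ℓ) ≡ start a + start ℓ
  sa≡ = start-+-prefix agr′
  e₀ : w (start (a + ℓ)) ≡ w (start ℓ)
  e₀ = trans (cong w sa≡) (agr (start ℓ) (≤-trans (start-< ℓ) (m≤m+n _ 1)))
  e₁ : w (start (a + ℓ) + 1) ≡ w (start ℓ + 1)
  e₁ = trans (cong w (trans (cong (_+ 1) sa≡) (+-assoc (start a) (start ℓ) 1)))
             (agr (start ℓ + 1) (+-monoˡ-< 1 (start-< ℓ)))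

-- Recognizability

start^ : ℕ → ℕ → ℕ
start^ zero    q = q
start^ (suc L) q = start (start^ L q)

start^-0 : ∀ L → start^ L 0 ≡ 0
start^-0 zero    = refl
start^-0 (suc L) = cong start (start^-0 L)

start^-< : ∀ L p → start^ L p < start^ L (suc p)
start^-< zero    p = n<1+n p
start^-< (suc L) p = step-<⇒mono-< start start-< (start^-< L p)

start^-mono-≤ : ∀ L {a b} → a ≤ b → start^ L a ≤ start^ L b
start^-mono-≤ L = step-<⇒mono-≤ (start^ L) (start^-< L)

start^-N : ∀ L k → start^ L (N k) ≡ N (k + L)
start^-N zero    k = cong N (sym (+-identityʳ k))
start^-N (suc L) k = trans (cong start (start^-N L k)) (trans (start-N (k + L)) (cong N (sym (+-suc k L))))

Agree-start^ : ∀ L {ℓ a b} → Agree ℓ a b →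
               ∃ λ X → start^ L (a + ℓ) ≡ start^ L a + X × start^ L (b + ℓ) ≡ start^ L b + X
                     × Agree X (start^ L a) (start^ L b)
Agree-start^ zero    {ℓ} agr = ℓ , refl , refl , agr
Agree-start^ (suc L) {ℓ} {a} {b} agr with X , a≡ , b≡ , agrX ← Agree-start^ L agr =
  imageLength (start^ L a) X ,
  trans (cong start a≡) (start-+ _ X) ,
  trans (cong start b≡) (trans (start-+ _ X) (cong (start (start^ L b) +_) (sym (Agree⇒imageLength≡ agrX)))) ,
  Agree-image agrX

e : ℕ → ℕ
e zero                = 1
e (suc zero)          = 0
e (suc (suc j))       = e j

e-suc : ∀ j → e (suc j) ≡ 1 ∸ e j
e-suc zero          = refl
e-suc (suc zero)    = refl
e-suc (suc (suc j)) = e-suc j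

e-0-or-1 : ∀ j → e j ≡ 0 ⊎ e j ≡ 1
e-0-or-1 zero          = inj₂ refl
e-0-or-1 (suc zero)    = inj₁ refl
e-0-or-1 (suc (suc j)) = e-0-or-1 j

e-+-e-suc : ∀ j → e j + e (suc j) ≡ 1
e-+-e-suc j with e-0-or-1 j
... | inj₁ e≡0 = trans (cong₂ _+_ e≡0 (e-suc j)) (cong (1 ∸_) e≡0)
... | inj₂ e≡1 = trans (cong₂ _+_ e≡1 (e-suc j)) (cong (λ k → 1 + (1 ∸ k)) e≡1)

-- The prefix of length β (suc j) is the image of the prefix of length β j, extended by one
-- letter exactly when e j = 1, i.e. when the latter prefix is empty or ends in 𝟏 (β-last):
-- then the next letter is forced, as it begins the image of a letter other than 𝟏.
β : ℕ → ℕ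
β zero    = 0
β (suc j) = start (β j) + e j

β-last : ∀ j → ∃ λ b → β (suc j) ≡ suc b × ((e (suc j) ≡ 1 × w b ≡ 𝟏) ⊎ (e (suc j) ≡ 0 × w b ≡ 𝟎))
β-last zero = 0 , refl , inj₂ (refl , w≡word 0)
β-last (suc j) with β-last j
... | b , βb , inj₁ (e≡1 , wb≡𝟏) =
  start (suc b) ,
  trans (cong₂ (λ x y → start x + y) βb e≡1) (+-comm (start (suc b)) 1) ,
  inj₂ (trans (e-suc (suc j)) (cong (1 ∸_) e≡1) , w-start-after-𝟏 wb≡𝟏)
... | b , βb , inj₂ (e≡0 , wb≡𝟎) =
  start b + 1 ,
  trans (cong₂ (λ x y → start x + y) βb e≡0)
        (trans (+-identityʳ (start (suc b))) (trans (start-suc-of wb≡𝟎) (+-suc (start b) 1))) ,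
  inj₁ (trans (e-suc (suc j)) (cong (1 ∸_) e≡0) , w-start+1 wb≡𝟎)

start^-begins-with-prefix : ∀ L q → Agree (β (suc L)) (start^ (2 + L) q) 0
start^-begins-with-prefix zero q =
  Agree-1 (trans (w-start (start q)) (trans (initial≡𝟎 (w-start≢𝟏 q)) (sym (w≡word 0))))
start^-begins-with-prefix (suc L) q = extend (β-last L)
  where
  x = start^ (2 + L) q
  y = β (suc L)
  agr : Agree y x 0
  agr = start^-begins-with-prefix L q
  extend : (∃ λ b → y ≡ suc b × ((e (suc L) ≡ 1 × w b ≡ 𝟏) ⊎ (e (suc L) ≡ 0 × w b ≡ 𝟎))) →
           Agree (start y + e (suc L)) (start x) 0
  extend (_ , _ , inj₂ (e≡0 , _)) =
    subst (λ k → Agree k (start x) 0) (trans (sym (+-identityʳ _)) (cong (start y +_) (sym e≡0)))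
          (Agree-start-prefix agr)
  extend (b , y≡ , inj₁ (e≡1 , wb≡𝟏)) =
    subst (λ k → Agree k (start x) 0) (trans (+-comm 1 (start y)) (cong (start y +_) (sym e≡1)))
          (Agree-snoc (Agree-start-prefix agr) next)
    where
    next : w (start x + start y) ≡ w (start y)
    next = begin
      w (start x + start y)   ≡⟨ cong w (start-+-prefix agr) ⟨
      w (start (x + y))       ≡⟨ cong (w ∘ start) (trans (cong (x +_) y≡) (+-suc x b)) ⟩
      w (start (suc (x + b))) ≡⟨ w-start-after-𝟏 (trans (agr b (subst (b <_) (sym y≡) (n<1+n b))) wb≡𝟏) ⟩
      𝟎                       ≡⟨ w-start-after-𝟏 wb≡𝟏 ⟨
      w (start (suc b))       ≡⟨ cong (w ∘ start) y≡ ⟨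
      w (start y)             ∎
      where open ≡-Reasoning

e≡1-or-β-ends-𝟎 : ∀ L → (e L ≡ 1) ⊎ (∃ λ b → β L ≡ suc b × w b ≡ 𝟎)
e≡1-or-β-ends-𝟎 zero = inj₁ refl
e≡1-or-β-ends-𝟎 (suc L) with β-last L
... | _ , _  , inj₁ (e≡1 , _)     = inj₁ e≡1
... | b , βb , inj₂ (_ , wb≡𝟎)   = inj₂ (b , βb , wb≡𝟎)

Agree-preimage-β : ∀ L {a} → Agree (suc (β (suc L))) (start a) 0 → Agree (suc (β L)) a 0
Agree-preimage-β L {a} agr = Agree-snoc agr-y (next-letter (e≡1-or-β-ends-𝟎 L))
  where
  y = β L
  agr-y : Agree y a 0
  agr-y = Agree-preimage-prefix (Agree-≤ (subst (_≤ suc (β (suc L))) (+-comm 1 (start y)) (s≤s (m≤m+n _ (e L)))) agr)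
  image-letter : ∀ r → r ≤ e L → w (start (a + y) + r) ≡ w (start y + r)
  image-letter r r≤ = trans (cong w (trans (cong (_+ r) (start-+-prefix agr-y)) (+-assoc (start a) (start y) r)))
                            (agr (start y + r) (s≤s (+-monoʳ-≤ (start y) r≤)))
  image-head : w (start (a + y)) ≡ w (start y)
  image-head = subst₂ (λ u v → w u ≡ w v) (+-identityʳ _) (+-identityʳ _) (image-letter 0 z≤n)
  next-letter : (e L ≡ 1) ⊎ (∃ λ b → y ≡ suc b × w b ≡ 𝟎) → w (a + y) ≡ w y
  next-letter (inj₁ e≡1)            = decode-image image-head (image-letter 1 (≤-reflexive (sym e≡1)))
  next-letter (inj₂ (b , y≡ , wb≡𝟎)) =
    subst₂ (λ u v → w u ≡ w v) (sym a+y≡) (sym y≡)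
      (decode-image-after-𝟎 (trans (agr-y b (subst (b <_) (sym y≡) (n<1+n b))) wb≡𝟎) wb≡𝟎
        (subst₂ (λ u v → w (start u) ≡ w (start v)) a+y≡ y≡ image-head))
    where
    a+y≡ : a + y ≡ suc (a + b)
    a+y≡ = trans (cong (a +_) y≡) (+-suc a b)

prefix-occurs-only-at-start^ : ∀ L {j} → Agree (suc (β L)) j 0 → ∃ λ q → j ≡ start^ (2 + L) q
prefix-occurs-only-at-start^ zero    agr = w≡𝟎⇒start² (trans (Agree-head agr) (w≡word 0))
prefix-occurs-only-at-start^ (suc L) agr
  with a , refl ← w≡𝟎⇒start (trans (Agree-head agr) (w≡word 0))
  with q , refl ← prefix-occurs-only-at-start^ L {a} (Agree-preimage-β L agr) = q , refl

-- Letter counts and D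

δ : Fin 3 → Fin 3 → ℕ
δ a c = if does (a ≟ c) then 1 else 0

count : Fin 3 → List (Fin 3) → ℕ
count c xs = sum (map (λ b → δ b c) xs)

occurrences : Fin 3 → ℕ → ℕ
occurrences c zero    = 0
occurrences c (suc x) = occurrences c x + δ (w x) c

occurrences-block : ∀ c xs a → (∀ r → r < length xs → w (a + r) ≡ at xs r) →
                    occurrences c (a + length xs) ≡ occurrences c a + count c xs
occurrences-block c []       a _   = trans (cong (occurrences c) (+-identityʳ a)) (sym (+-identityʳ _))
occurrences-block c (x ∷ xs) a blk = begin
  occurrences c (a + suc (length xs))        ≡⟨ cong (occurrences c) (+-suc a _) ⟩
  occurrences c (suc a + length xs)          ≡⟨ occurrences-block c xs (suc a) blk′ ⟩
  occurrences c a + δ (w a) c + count c xs   ≡⟨ cong (λ b → occurrences c a + δ b c + count c xs) wa≡x ⟩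
  occurrences c a + δ x c + count c xs       ≡⟨ +-assoc (occurrences c a) _ _ ⟩
  occurrences c a + count c (x ∷ xs)         ∎
  where
  open ≡-Reasoning
  wa≡x : w a ≡ x
  wa≡x = trans (cong w (sym (+-identityʳ a))) (blk 0 (s≤s z≤n))
  blk′ : ∀ r → r < length xs → w (suc a + r) ≡ at xs r
  blk′ r r< = trans (cong w (sym (+-suc a r))) (blk (suc r) (s≤s r<))

occurrences-start-suc : ∀ c x → occurrences c (start (suc x)) ≡ occurrences c (start x) + count c (φ₁ (w x))
occurrences-start-suc c x = occurrences-block c (φ₁ (w x)) (start x) (λ r r< → w-image x r<)

start≡+occurrences-𝟎 : ∀ x → start x ≡ x + occurrences 𝟎 x
start≡+occurrences-𝟎 zero    = refl
start≡+occurrences-𝟎 (suc x) = begin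
  start x + len (w x)                           ≡⟨ cong₂ _+_ (start≡+occurrences-𝟎 x) (len≡ (w x)) ⟩
  x + occurrences 𝟎 x + suc (δ (w x) 𝟎)         ≡⟨ +-suc (x + occurrences 𝟎 x) _ ⟩
  suc (x + occurrences 𝟎 x + δ (w x) 𝟎)         ≡⟨ cong suc (+-assoc x _ _) ⟩
  suc x + (occurrences 𝟎 x + δ (w x) 𝟎)         ∎
  where
  open ≡-Reasoning
  len≡ : ∀ a → len a ≡ suc (δ a 𝟎)
  len≡ 𝟎 = refl
  len≡ 𝟏 = refl
  len≡ 𝟐 = refl

occurrences-𝟏-start : ∀ x → occurrences 𝟏 (start x) ≡ occurrences 𝟎 x
occurrences-𝟏-start zero    = refl
occurrences-𝟏-start (suc x) =
  trans (occurrences-start-suc 𝟏 x) (cong₂ _+_ (occurrences-𝟏-start x) (count-𝟏-φ₁ (w x)))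
  where
  count-𝟏-φ₁ : ∀ a → count 𝟏 (φ₁ a) ≡ δ a 𝟎
  count-𝟏-φ₁ 𝟎 = refl
  count-𝟏-φ₁ 𝟏 = refl
  count-𝟏-φ₁ 𝟐 = refl

occurrences-𝟎-start : ∀ x → occurrences 𝟎 (start x) + occurrences 𝟏 x ≡ x
occurrences-𝟎-start zero    = refl
occurrences-𝟎-start (suc x) = begin
  occurrences 𝟎 (start (suc x)) + occurrences 𝟏 (suc x)
    ≡⟨ cong (_+ occurrences 𝟏 (suc x)) (occurrences-start-suc 𝟎 x) ⟩
  (occurrences 𝟎 (start x) + count 𝟎 (φ₁ (w x))) + (occurrences 𝟏 x + δ (w x) 𝟏)
    ≡⟨ interchange (occurrences 𝟎 (start x)) _ _ _ ⟩
  (occurrences 𝟎 (start x) + occurrences 𝟏 x) + (count 𝟎 (φ₁ (w x)) + δ (w x) 𝟏)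
    ≡⟨ cong₂ _+_ (occurrences-𝟎-start x) (count-𝟎-φ₁ (w x)) ⟩
  x + 1
    ≡⟨ +-comm x 1 ⟩
  suc x ∎
  where
  open ≡-Reasoning
  count-𝟎-φ₁ : ∀ a → count 𝟎 (φ₁ a) + δ a 𝟏 ≡ 1
  count-𝟎-φ₁ 𝟎 = refl
  count-𝟎-φ₁ 𝟏 = refl
  count-𝟎-φ₁ 𝟐 = refl

w-start-β : ∀ j → e j ≡ 1 → w (start (β j)) ≡ 𝟎
w-start-β zero    _   = w≡word 0
w-start-β (suc j) e≡1 with β-last j
... | b , βb , inj₁ (_ , wb≡𝟏) = subst (λ x → w (start x) ≡ 𝟎) (sym βb) (w-start-after-𝟏 wb≡𝟏)
... | _ , _  , inj₂ (e≡0 , _) with () ← trans (sym e≡0) e≡1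

occurrences-β-suc : ∀ j → occurrences 𝟎 (β (suc j)) ≡ occurrences 𝟎 (start (β j)) + e j
                        × occurrences 𝟏 (β (suc j)) ≡ occurrences 𝟏 (start (β j))
occurrences-β-suc j with e-0-or-1 j
... | inj₁ e≡0 =
  trans (cong (occurrences 𝟎) β≡) (sym (trans (cong (occurrences 𝟎 (start (β j)) +_) e≡0) (+-identityʳ _))) ,
  cong (occurrences 𝟏) β≡
  where
  β≡ : β (suc j) ≡ start (β j)
  β≡ = trans (cong (start (β j) +_) e≡0) (+-identityʳ _)
... | inj₂ e≡1 =
  trans (cong (occurrences 𝟎) β≡) (cong (occurrences 𝟎 (start (β j)) +_) (trans (cong (λ a → δ a 𝟎) w≡𝟎) (sym e≡1))) ,
  trans (cong (occurrences 𝟏) β≡) (trans (cong (λ a → occurrences 𝟏 (start (β j)) + δ a 𝟏) w≡𝟎) (+-identityʳ _))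
  where
  β≡ : β (suc j) ≡ suc (start (β j))
  β≡ = trans (cong (start (β j) +_) e≡1) (+-comm (start (β j)) 1)
  w≡𝟎 : w (start (β j)) ≡ 𝟎
  w≡𝟎 = w-start-β j e≡1

occurrences-𝟎-β : ∀ j → occurrences 𝟎 (β (2 + j)) ≡ suc (β j)
occurrences-𝟎-β j = +-cancelʳ-≡ (occurrences 𝟎 B) _ _ (begin
  occurrences 𝟎 B₂ + occurrences 𝟎 B
    ≡⟨ cong₂ _+_ (proj₁ (occurrences-β-suc (suc j))) (sym occ𝟏B₁) ⟩
  occurrences 𝟎 (start B₁) + e (suc j) + occurrences 𝟏 B₁
    ≡⟨ +-rotate (occurrences 𝟎 (start B₁)) (e (suc j)) (occurrences 𝟏 B₁) ⟩
  occurrences 𝟎 (start B₁) + occurrences 𝟏 B₁ + e (suc j)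
    ≡⟨ cong₂ _+_ (occurrences-𝟎-start B₁) refl ⟩
  start B + e j + e (suc j)
    ≡⟨ +-assoc (start B) (e j) _ ⟩
  start B + (e j + e (suc j))
    ≡⟨ cong₂ _+_ (start≡+occurrences-𝟎 B) (e-+-e-suc j) ⟩
  B + occurrences 𝟎 B + 1
    ≡⟨ +-rotate B _ 1 ⟩
  B + 1 + occurrences 𝟎 B
    ≡⟨ cong (_+ occurrences 𝟎 B) (+-comm B 1) ⟩
  suc B + occurrences 𝟎 B ∎)
  where
  open ≡-Reasoning
  B = β j
  B₁ = β (suc j)
  B₂ = β (2 + j)
  occ𝟏B₁ : occurrences 𝟏 B₁ ≡ occurrences 𝟎 B
  occ𝟏B₁ = trans (proj₂ (occurrences-β-suc j)) (occurrences-𝟏-start B)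
  +-rotate : ∀ x y z → x + y + z ≡ x + z + y
  +-rotate = solve-∀

β-+3 : ∀ j → β (3 + j) ≡ β (2 + j) + suc (β j) + e j
β-+3 j = cong (_+ e j) (trans (start≡+occurrences-𝟎 (β (2 + j))) (cong (β (2 + j) +_) (occurrences-𝟎-β j)))

narayana-step : ∀ {a b c u v ε ε′} → ε + ε′ ≡ 1 →
                a + 2 * c ≡ b + (suc ε + suc u * 3) →
                c + 2 * (c + a + b) ≡ (c + a) + (suc ε + suc v * 3) →
                (c + a) + 2 * (c + a + b + c) ≡ (c + a + b) + (suc ε′ + suc (v + suc u + ε) * 3)
narayana-step {a} {b} {c} {u} {v} {ε} {ε′} ε+ε′≡1 h₁ h₂ = begin
  (c + a) + 2 * (c + a + b + c)                                   ≡⟨ split a b c ⟩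
  (a + 2 * c) + (c + 2 * (c + a + b))                             ≡⟨ cong₂ _+_ h₁ h₂ ⟩
  (b + (suc ε + suc u * 3)) + ((c + a) + (suc ε + suc v * 3))     ≡⟨ regroup a b c u v ε ⟩
  (c + a + b) + (7 + 2 * ε + 3 * u + 3 * v) + 1                   ≡⟨ cong ((c + a + b) + (7 + 2 * ε + 3 * u + 3 * v) +_) ε+ε′≡1 ⟨
  (c + a + b) + (7 + 2 * ε + 3 * u + 3 * v) + (ε + ε′)            ≡⟨ collect a b c u v ε ε′ ⟩
  (c + a + b) + (suc ε′ + suc (v + suc u + ε) * 3)                ∎
  where
  open ≡-Reasoning
  split : ∀ a b c → (c + a) + 2 * (c + a + b + c) ≡ (a + 2 * c) + (c + 2 * (c + a + b))
  split = solve-∀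
  regroup : ∀ a b c u v ε → (b + (suc ε + suc u * 3)) + ((c + a) + (suc ε + suc v * 3))
                          ≡ (c + a + b) + (7 + 2 * ε + 3 * u + 3 * v) + 1
  regroup = solve-∀
  collect : ∀ a b c u v ε ε′ → (c + a + b) + (7 + 2 * ε + 3 * u + 3 * v) + (ε + ε′)
                              ≡ (c + a + b) + (suc ε′ + suc (v + suc u + ε) * 3)
  collect = solve-∀

narayana-β : ∀ j → N j + 2 * N (2 + j) ≡ N (1 + j) + (suc (e j) + suc (β j) * 3)
narayana-β zero             = refl
narayana-β (suc zero)       = refl
narayana-β (suc (suc zero)) = cong (λ s → N 3 + (suc (e 2) + suc (s + e 1) * 3)) (sym (start-N 0))
narayana-β (suc (suc (suc j))) =
  trans (narayana-step {N j} {N (1 + j)} {N (2 + j)} {β j} {β (2 + j)}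
                       (e-+-e-suc j) (narayana-β j) (narayana-β (suc (suc j))))
        (cong (λ v → N (4 + j) + (suc (e (suc j)) + suc v * 3)) (sym (β-+3 j)))

D≡suc-β : ∀ j → D j ≡ suc (β j)
D≡suc-β j = begin
  (N j + 2 * N (2 + j) ∸ N (1 + j)) / 3               ≡⟨ cong (λ n → (n ∸ N (1 + j)) / 3) (narayana-β j) ⟩
  (N (1 + j) + (suc (e j) + suc (β j) * 3) ∸ N (1 + j)) / 3 ≡⟨ cong (_/ 3) (m+n∸m≡n (N (1 + j)) _) ⟩
  (suc (e j) + suc (β j) * 3) / 3                     ≡⟨ +-distrib-/-∣ʳ (suc (e j)) {d = 3} (divides-refl (suc (β j))) ⟩
  suc (e j) / 3 + suc (β j) * 3 / 3                   ≡⟨ cong₂ _+_ (m<n⇒m/n≡0 (s≤s (s≤s e≤1))) (m*n/n≡m (suc (β j)) 3) ⟩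
  suc (β j)                                           ∎
  where
  open ≡-Reasoning
  e≤1 : e j ≤ 1
  e≤1 with e-0-or-1 j
  ... | inj₁ e≡0 = ≤-trans (≤-reflexive e≡0) z≤n
  ... | inj₂ e≡1 = ≤-reflexive e≡1

-- The block containing k and the block of the first occurrence q₀ of the same letter agree
-- and are followed by the same prefix, so the factor at k also occurs inside block q₀.
AllFactorsBy-N∸1 : ∀ i {m′} → m′ ≤ β (suc i) → AllFactorsBy (suc m′) (N (4 + i) ∸ 1)
AllFactorsBy-N∸1 i {m′} m′≤ k
  with q , t , k≡ , k< ← bracket (start^ (2 + i)) (start^-0 (2 + i)) (start^-< (2 + i)) k
  with X , q-block , q₀-block , agrX ← Agree-start^ (2 + i) {1} {q} {toℕ (w q)} (Agree-1 (sym (w-toℕ (w q))))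
  = j , <⇒≤∸1 j< , Agree⇒OccursAt (Agree-sym (subst (λ x → Agree (suc m′) x j) (sym k≡) occ))
  where
  L = 2 + i
  q₀ = toℕ (w q)
  j = start^ L q₀ + t
  after-block : ∀ p → start^ L (p + 1) ≡ start^ L p + X → Agree (β (suc i)) (start^ L p + X) 0
  after-block p block = subst (λ x → Agree (β (suc i)) x 0) (trans (cong (start^ L) (+-comm 1 p)) block)
                              (start^-begins-with-prefix i (suc p))
  t<X : t < X
  t<X = +-cancelˡ-< (start^ L q) t X (subst₂ _<_ k≡ (trans (cong (start^ L) (+-comm 1 q)) q-block) k<)
  occ : Agree (suc m′) (start^ L q + t) j
  occ = Agree-drop t (subst (_≤ X + β (suc i)) (sym (+-suc t m′)) (+-mono-≤ t<X m′≤))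
                     (Agree-++ agrX (Agree-trans (after-block q q-block) (Agree-sym (after-block q₀ q₀-block))))
  j< : j < N (4 + i)
  j< = begin-strict
    start^ L q₀ + t       <⟨ +-monoʳ-< (start^ L q₀) t<X ⟩
    start^ L q₀ + X       ≡⟨ trans (cong (start^ L) (+-comm 1 q₀)) q₀-block ⟨
    start^ L (suc q₀)     ≤⟨ start^-mono-≤ L (toℕ<n (w q)) ⟩
    start^ L 3            ≡⟨ start^-N L 2 ⟩
    N (4 + i)             ∎
    where open ≤-Reasoning

-- An occurrence j < N (4 + i) − 1 of the factor at N (4 + i) − 1 puts the recognizable prefix
-- at j + 1, so j + 1 is a cut, and no cut q fits: q = 1, 2 by the last letters, q ≥ 3 by size.
AllFactorsBy⇒N∸1≤ : ∀ i {m′} → suc (β i) ≤ m′ → m′ ≤ β (suc i) →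
                          ∀ y → AllFactorsBy (suc m′) y → N (4 + i) ∸ 1 ≤ y
AllFactorsBy⇒N∸1≤ i {m′} lo hi y factors with N (4 + i) ∸ 1 ≤? y
... | yes c≤y = c≤y
... | no  c≰y = ⊥-elim (impossible (prefix-occurs-only-at-start^ i (Agree-≤ lo suc-j-begins-with-prefix)))
  where
  L = 2 + i
  c = N (4 + i) ∸ 1
  j = proj₁ (factors c)
  j<c : j < c
  j<c = ≤-<-trans (proj₁ (proj₂ (factors c))) (≰⇒> c≰y)
  occ : Agree (suc m′) j c
  occ = OccursAt⇒Agree (proj₂ (proj₂ (factors c)))
  suc-c≡ : c + 1 ≡ start^ L 3
  suc-c≡ = trans (m∸n+n≡m (N-positive (4 + i))) (sym (start^-N L 2))
  suc-j-begins-with-prefix : Agree m′ (suc j) 0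
  suc-j-begins-with-prefix =
    Agree-trans (subst₂ (Agree m′) (+-comm j 1) suc-c≡ (Agree-drop 1 ≤-refl occ))
                (Agree-≤ hi (start^-begins-with-prefix i 3))
  lastLetter-at : ∀ k → suc j ≡ N k → lastLetter (4 + i) ≡ lastLetter k
  lastLetter-at k sj≡ =
    trans (sym (trans (Agree-head occ) (w-N∸1 (4 + i)))) (trans (cong (w ∘ (_∸ 1)) sj≡) (w-N∸1 k))
  impossible : (∃ λ q → suc j ≡ start^ L q) → ⊥
  impossible (zero , sj≡) with () ← trans sj≡ (start^-0 L)
  impossible (suc zero , sj≡) =
    lastLetter-suc-≢ (4 + i) (trans (lastLetter-at L (trans sj≡ (start^-N L 0))) (sym (lastLetter-+3 L)))
  impossible (suc (suc zero) , sj≡) =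
    lastLetter-suc-≢ (3 + i) (sym (lastLetter-at (3 + i) (trans sj≡ (start^-N L 1))))
  impossible (suc (suc (suc q)) , sj≡) = <-irrefl refl (begin-strict
    suc j                 <⟨ s≤s j<c ⟩
    suc c                 ≡⟨ trans (+-comm 1 c) suc-c≡ ⟩
    start^ L 3            ≤⟨ start^-mono-≤ L (s≤s (s≤s (s≤s z≤n))) ⟩
    start^ L (3 + q)      ≡⟨ sj≡ ⟨
    suc j                 ∎)
    where open ≤-Reasoning

theorem9 : ∀ (m i : ℕ) → 2 ≤ m → D i < m → m ≤ D (i + 1) → IsA m (N (i + 4) ∸ 1)
theorem9 (suc m′) i _ Di<m m≤Di+1 =
  subst (λ n → IsA (suc m′) (N n ∸ 1)) (+-comm 4 i) (AllFactorsBy-N∸1 i hi , AllFactorsBy⇒N∸1≤ i lo hi)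
  where
  lo : suc (β i) ≤ m′
  lo = ≤-pred (subst (_< suc m′) (D≡suc-β i) Di<m)
  hi : m′ ≤ β (suc i)
  hi = ≤-pred (subst (suc m′ ≤_) (trans (cong D (+-comm i 1)) (D≡suc-β (suc i))) m≤Di+1)
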